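{- Let $m>1$ be an integer and let $h$ be the largest odd integer not exceeding $m$. A position $M=(n_0,n_1,\dots,n_{2m-1})$ of ${\rm ECN}((2m)_{\{1,3,\dots,h\}},2)$ is a $\mathcal{P}$-position if and only if $n_0\oplus n_2\oplus\cdots\oplus n_{2m-2}=n_1\oplus n_3\oplus\cdots\oplus n_{2m-1}=0$.
   Context: Extended circular nim ${\rm ECN}(N_S,k)$ (positive integers $k\le N$, $S$ a set of positive integers each at most $N/2$): there are $N$ piles $v_0,\dots,v_{N-1}$ arranged in a circle (indices mod $N$); a position is a tuple $(n_0,\dots,n_{N-1})$ of nonnegative integers, $n_i$ being the number of tokens on $v_i$. A move chooses $s\in S$, $i\in\{0,\dots,N-1\}$, $j\in\{0,\dots,k-1\}$ and removes an arbitrary nonnegative number of tokens from each pile $v_{(i+ts)\bmod N}$, $t=0,\dots,j$, removing at least one token in total (empty piles still count as piles). Normal play: the player unable to move loses. A $\mathcal{P}$-position is a position from which the previous player (the player who just moved) has a winning strategy. $\oplus$ denotes bitwise exclusive OR (nim-sum). The set $\{1,3,\dots,h\}$ is the set of all odd integers from $1$ to $h$. -}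

module Defs where

open import Data.Nat using (ℕ; zero; suc; _+_; _*_; _≤_; _<_; _<?_)
open import Data.Nat.DivMod using (_%_; _/_)
open import Data.Fin using (Fin; toℕ; fromℕ<)
open import Data.Product using (Σ; ∃; _×_)
open import Relation.Nullary using (¬_; yes; no)
open import Relation.Binary.PropositionalEquality using (_≡_)

-- Bitwise exclusive OR (nim-sum) on ℕ.
-- xorF f a b processes f low-order bit positions; with fuel a + b this
-- covers all bits of a and b (each step halves both), so ⊕ is the
-- usual bitwise XOR.

bitXor : ℕ → ℕ → ℕ
bitXor 0 0 = 0
bitXor 0 _ = 1
bitXor _ 0 = 1
bitXor _ _ = 0

xorF : ℕ → ℕ → ℕ → ℕ
xorF zero    a b = 0
xorF (suc f) a b = bitXor (a % 2) (b % 2) + 2 * xorF f (a / 2) (b / 2)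

infixl 6 _⊕_
_⊕_ : ℕ → ℕ → ℕ
a ⊕ b = xorF (a + b) a b

bigXor : ℕ → (ℕ → ℕ) → ℕ
bigXor zero    f = 0
bigXor (suc n) f = bigXor n f ⊕ f n

Position : ℕ → Set
Position N = Fin N → ℕ

-- number of tokens on pile v_x (used only for x < N; 0 otherwise)
pile : ∀ {N} → Position N → ℕ → ℕ
pile {N} p x with x <? N
... | yes x<N = p (fromℕ< x<N)
... | no  _   = 0

-- A move: choose s ∈ S, i ∈ {0..N-1}, j ∈ {0..k-1}; remove any number of
-- tokens from each pile v_{(i + t s) mod N}, t = 0..j, at least one in total.

-- pile x is among v_{(i+ts) mod N}, t = 0..j; since toℕ x < N,
-- "toℕ x = (i + t s) mod N" is expressed as  x + c N = i + t s  for some c.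
InBlock : (N s : ℕ) → Fin N → (j : ℕ) → Fin N → Set
InBlock N s i j x =
  Σ ℕ λ t → t ≤ j × (Σ ℕ λ c → toℕ x + c * N ≡ toℕ i + t * s)

Move : (N : ℕ) (S : ℕ → Set) (k : ℕ) → Position N → Position N → Set
Move N S k p q =
  Σ ℕ λ s → S s × Σ (Fin N) λ i → Σ ℕ λ j → j < k ×
    ((∀ x → q x ≤ p x) ×
     (∀ x → ¬ InBlock N s i j x → q x ≡ p x) ×
     (Σ (Fin N) λ x → q x < p x))

mutual
  data IsP (N : ℕ) (S : ℕ → Set) (k : ℕ) (p : Position N) : Set where
    isP : (∀ q → Move N S k p q → IsN N S k q) → IsP N S k p

  data IsN (N : ℕ) (S : ℕ → Set) (k : ℕ) (p : Position N) : Set where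
    isN : (q : Position N) → Move N S k p q → IsP N S k q → IsN N S k p

OddUpTo : ℕ → ℕ → Set
OddUpTo h s = s % 2 ≡ 1 × s ≤ h

{-# OPTIONS --safe #-}
module Submission where

-- Since 2m is even and every admissible s is odd, the (at most two) piles
-- v_i and v_(i+s) touched by a move have opposite parity: a move changes at
-- most one pile of each parity class.  So from a position whose even-class
-- and odd-class nim-sums both vanish, every move makes one of them nonzero.
-- Conversely, the Nim strategy zeroes a nonzero class nim-sum by lowering a
-- single pile of that class; if both are nonzero, the two piles to lower
-- (one even, one odd) are at odd circular distance d and 2m − d, and one of
-- these is at most h because h is odd and m ≤ h + 1, so one move with j = 1
-- lowers both.  The balanced positions are therefore the kernel of the
-- finite acyclic game graph, i.e. exactly the P-positions.

open import Defs
open import Data.Nat using (ℕ; zero; suc; _+_; _*_; _≤_; _<_; z≤n; s≤s; s≤s⁻¹; z<s)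
open import Data.Nat.DivMod
open import Data.Nat.Properties
open import Data.Nat.Tactic.RingSolver using (solve-∀)
open import Data.Fin as Fin using (Fin; toℕ; fromℕ<)
open import Data.Fin.Properties using (toℕ-injective; toℕ<n; fromℕ<-toℕ; toℕ-fromℕ<)
open import Data.Vec.Functional using (updateAt)
open import Data.Vec.Functional.Properties using (updateAt-updates; updateAt-minimal)
open import Data.Product using (∃; _×_; _,_; proj₁; proj₂; map₁)
open import Data.Sum using (_⊎_; inj₁; inj₂; swap)
open import Data.Empty using (⊥-elim)
open import Function using (_∘_; const)
open import Function.Bundles using (_⇔_; mk⇔)
open import Function.Construct.Composition using (_⇔-∘_)
open import Relation.Nullary using (¬_; Dec; yes; no; contradiction)
open import Relation.Nullary.Decidable using (decidable-stable; _×-dec_)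
open import Relation.Binary.PropositionalEquality

-- Nim-sum

bitXor-comm : ∀ a b → bitXor a b ≡ bitXor b a
bitXor-comm zero    zero    = refl
bitXor-comm zero    (suc b) = refl
bitXor-comm (suc a) zero    = refl
bitXor-comm (suc a) (suc b) = refl

bitXor-assoc : ∀ a b c → bitXor (bitXor a b) c ≡ bitXor a (bitXor b c)
bitXor-assoc zero    zero    zero    = refl
bitXor-assoc zero    zero    (suc c) = refl
bitXor-assoc zero    (suc b) zero    = refl
bitXor-assoc zero    (suc b) (suc c) = refl
bitXor-assoc (suc a) zero    zero    = refl
bitXor-assoc (suc a) zero    (suc c) = refl
bitXor-assoc (suc a) (suc b) zero    = refl
bitXor-assoc (suc a) (suc b) (suc c) = refl

bitXor-self : ∀ a → bitXor a a ≡ 0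
bitXor-self zero    = refl
bitXor-self (suc a) = refl

bitXor-identityʳ : ∀ {r} → r < 2 → bitXor r 0 ≡ r
bitXor-identityʳ {0}           _ = refl
bitXor-identityʳ {1}           _ = refl
bitXor-identityʳ {suc (suc _)} (s≤s (s≤s ()))

bitXor<2 : ∀ a b → bitXor a b < 2
bitXor<2 zero    zero    = z<s
bitXor<2 zero    (suc b) = ≤-refl
bitXor<2 (suc a) zero    = ≤-refl
bitXor<2 (suc a) (suc b) = z<s

%2-cases : ∀ a → a % 2 ≡ 0 ⊎ a % 2 ≡ 1
%2-cases a with a % 2 | m%n<n a 2
... | 0           | _              = inj₁ refl
... | 1           | _              = inj₂ refl
... | suc (suc _) | s≤s (s≤s ())

m≡2[m/2]+m%2 : ∀ a → a ≡ 2 * (a / 2) + a % 2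
m≡2[m/2]+m%2 a =
  trans (m≡m%n+[m/n]*n a 2) (trans (+-comm (a % 2) _) (cong (_+ a % 2) (*-comm (a / 2) 2)))

[2q+r]%2≡r : ∀ q {r} → r < 2 → (2 * q + r) % 2 ≡ r
[2q+r]%2≡r q {r} r<2 = begin
  (2 * q + r) % 2 ≡⟨ cong (_% 2) (trans (+-comm (2 * q) r) (cong (r +_) (*-comm 2 q))) ⟩
  (r + q * 2) % 2 ≡⟨ [m+kn]%n≡m%n r q 2 ⟩
  r % 2           ≡⟨ m<n⇒m%n≡m r<2 ⟩
  r               ∎
  where open ≡-Reasoning

[2q+r]/2≡q : ∀ q {r} → r < 2 → (2 * q + r) / 2 ≡ q
[2q+r]/2≡q q {r} r<2 = sym (*-cancelˡ-≡ q _ 2 (+-cancelʳ-≡ r (2 * q) _ (begin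
  2 * q + r                               ≡⟨ m≡2[m/2]+m%2 (2 * q + r) ⟩
  2 * ((2 * q + r) / 2) + (2 * q + r) % 2 ≡⟨ cong (2 * ((2 * q + r) / 2) +_) ([2q+r]%2≡r q r<2) ⟩
  2 * ((2 * q + r) / 2) + r               ∎)))
  where open ≡-Reasoning

≡-by-halves : ∀ {a b} → a / 2 ≡ b / 2 → a % 2 ≡ b % 2 → a ≡ b
≡-by-halves {a} {b} a/2≡b/2 a%2≡b%2 = begin
  a                   ≡⟨ m≡2[m/2]+m%2 a ⟩
  2 * (a / 2) + a % 2 ≡⟨ cong₂ (λ q r → 2 * q + r) a/2≡b/2 a%2≡b%2 ⟩
  2 * (b / 2) + b % 2 ≡⟨ m≡2[m/2]+m%2 b ⟨
  b                   ∎
  where open ≡-Reasoning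

/2-<⇒< : ∀ {a b} → a / 2 < b / 2 → a < b
/2-<⇒< a/2<b/2 = ≰⇒> λ b≤a → <⇒≱ a/2<b/2 (/-monoˡ-≤ 2 b≤a)

%2-<⇒< : ∀ {a b} → a / 2 ≡ b / 2 → a % 2 < b % 2 → a < b
%2-<⇒< {a} {b} a/2≡b/2 a%2<b%2 = begin-strict
  a                   ≡⟨ m≡2[m/2]+m%2 a ⟩
  2 * (a / 2) + a % 2 <⟨ +-mono-≤-< (≤-reflexive (cong (2 *_) a/2≡b/2)) a%2<b%2 ⟩
  2 * (b / 2) + b % 2 ≡⟨ m≡2[m/2]+m%2 b ⟨
  b                   ∎
  where open ≤-Reasoning

/2≤pred : ∀ {a n} → a ≤ suc n → a / 2 ≤ n
/2≤pred {zero}  _     = z≤n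
/2≤pred {suc a} a≤1+n = s≤s⁻¹ (<-≤-trans (m/n<m (suc a) 2 ≤-refl) a≤1+n)

halving-induction : (P : ℕ → ℕ → ℕ → Set) → P 0 0 0 →
  (∀ a b c → P (a / 2) (b / 2) (c / 2) → P a b c) → ∀ a b c → P a b c
halving-induction P base step a b c =
  go (a + b + c) (≤-trans (m≤m+n a b) (m≤m+n _ c)) (≤-trans (m≤n+m b a) (m≤m+n _ c)) (m≤n+m c _)
  where
  go : ∀ n {a b c} → a ≤ n → b ≤ n → c ≤ n → P a b c
  go zero    z≤n z≤n z≤n = base
  go (suc n) {a} {b} {c} a≤ b≤ c≤ = step a b c (go n (/2≤pred a≤) (/2≤pred b≤) (/2≤pred c≤))

xorF-fuel : ∀ {f g a b} → a ≤ f → b ≤ f → a ≤ g → b ≤ g → xorF f a b ≡ xorF g a b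
xorF-fuel {zero}  {zero}  _   _   _   _   = refl
xorF-fuel {zero}  {suc g} z≤n z≤n _   _   = cong (2 *_) (xorF-fuel {zero} {g} z≤n z≤n z≤n z≤n)
xorF-fuel {suc f} {zero}  _   _   z≤n z≤n = cong (2 *_) (xorF-fuel {f} {zero} z≤n z≤n z≤n z≤n)
xorF-fuel {suc f} {suc g} {a} {b} a≤f b≤f a≤g b≤g = cong (λ x → bitXor (a % 2) (b % 2) + 2 * x)
  (xorF-fuel (/2≤pred a≤f) (/2≤pred b≤f) (/2≤pred a≤g) (/2≤pred b≤g))

⊕-unfold : ∀ a b → a ⊕ b ≡ bitXor (a % 2) (b % 2) + 2 * (a / 2 ⊕ b / 2)
⊕-unfold a b = begin
  xorF (a + b) a b
    ≡⟨ xorF-fuel a≤a+b b≤a+b (m≤n⇒m≤1+n a≤a+b) (m≤n⇒m≤1+n b≤a+b) ⟩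
  bitXor (a % 2) (b % 2) + 2 * xorF (a + b) (a / 2) (b / 2)
    ≡⟨ cong (λ x → bitXor (a % 2) (b % 2) + 2 * x)
         (xorF-fuel (≤-trans (m/n≤m a 2) a≤a+b) (≤-trans (m/n≤m b 2) b≤a+b)
                    (m≤m+n (a / 2) (b / 2)) (m≤n+m (b / 2) (a / 2))) ⟩
  bitXor (a % 2) (b % 2) + 2 * (a / 2 ⊕ b / 2) ∎
  where
  open ≡-Reasoning
  a≤a+b : a ≤ a + b
  a≤a+b = m≤m+n a b
  b≤a+b : b ≤ a + b
  b≤a+b = m≤n+m b a

⊕-%2 : ∀ a b → (a ⊕ b) % 2 ≡ bitXor (a % 2) (b % 2)
⊕-%2 a b = trans (cong (_% 2) (trans (⊕-unfold a b) (+-comm (bitXor (a % 2) (b % 2)) _)))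
                 ([2q+r]%2≡r (a / 2 ⊕ b / 2) (bitXor<2 (a % 2) (b % 2)))

⊕-/2 : ∀ a b → (a ⊕ b) / 2 ≡ a / 2 ⊕ b / 2
⊕-/2 a b = trans (cong (_/ 2) (trans (⊕-unfold a b) (+-comm (bitXor (a % 2) (b % 2)) _)))
                 ([2q+r]/2≡q (a / 2 ⊕ b / 2) (bitXor<2 (a % 2) (b % 2)))

⊕-comm : ∀ a b → a ⊕ b ≡ b ⊕ a
⊕-comm a b = halving-induction (λ a b _ → a ⊕ b ≡ b ⊕ a) refl
  (λ a b _ ih → ≡-by-halves (trans (⊕-/2 a b) (trans ih (sym (⊕-/2 b a))))
                            (trans (⊕-%2 a b) (trans (bitXor-comm _ _) (sym (⊕-%2 b a)))))
  a b 0

⊕-identityʳ : ∀ a → a ⊕ 0 ≡ a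
⊕-identityʳ a = halving-induction (λ a _ _ → a ⊕ 0 ≡ a) refl
  (λ a _ _ ih → ≡-by-halves (trans (⊕-/2 a 0) ih)
                            (trans (⊕-%2 a 0) (bitXor-identityʳ (m%n<n a 2))))
  a 0 0

⊕-identityˡ : ∀ a → 0 ⊕ a ≡ a
⊕-identityˡ a = trans (⊕-comm 0 a) (⊕-identityʳ a)

⊕-self : ∀ a → a ⊕ a ≡ 0
⊕-self a = halving-induction (λ a _ _ → a ⊕ a ≡ 0) refl
  (λ a _ _ ih → ≡-by-halves (trans (⊕-/2 a a) ih) (trans (⊕-%2 a a) (bitXor-self _)))
  a 0 0

⊕-assoc : ∀ a b c → a ⊕ b ⊕ c ≡ a ⊕ (b ⊕ c)
⊕-assoc = halving-induction (λ a b c → a ⊕ b ⊕ c ≡ a ⊕ (b ⊕ c)) refl step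
  where
  open ≡-Reasoning
  step : ∀ a b c → a / 2 ⊕ b / 2 ⊕ c / 2 ≡ a / 2 ⊕ (b / 2 ⊕ c / 2) →
         a ⊕ b ⊕ c ≡ a ⊕ (b ⊕ c)
  step a b c ih = ≡-by-halves
    (begin
      (a ⊕ b ⊕ c) / 2           ≡⟨ ⊕-/2 (a ⊕ b) c ⟩
      (a ⊕ b) / 2 ⊕ c / 2       ≡⟨ cong (_⊕ c / 2) (⊕-/2 a b) ⟩
      a / 2 ⊕ b / 2 ⊕ c / 2     ≡⟨ ih ⟩
      a / 2 ⊕ (b / 2 ⊕ c / 2)   ≡⟨ cong (a / 2 ⊕_) (⊕-/2 b c) ⟨
      a / 2 ⊕ (b ⊕ c) / 2       ≡⟨ ⊕-/2 a (b ⊕ c) ⟨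
      (a ⊕ (b ⊕ c)) / 2         ∎)
    (begin
      (a ⊕ b ⊕ c) % 2                         ≡⟨ ⊕-%2 (a ⊕ b) c ⟩
      bitXor ((a ⊕ b) % 2) (c % 2)            ≡⟨ cong (λ r → bitXor r (c % 2)) (⊕-%2 a b) ⟩
      bitXor (bitXor (a % 2) (b % 2)) (c % 2) ≡⟨ bitXor-assoc (a % 2) (b % 2) (c % 2) ⟩
      bitXor (a % 2) (bitXor (b % 2) (c % 2)) ≡⟨ cong (bitXor (a % 2)) (⊕-%2 b c) ⟨
      bitXor (a % 2) ((b ⊕ c) % 2)            ≡⟨ ⊕-%2 a (b ⊕ c) ⟨
      (a ⊕ (b ⊕ c)) % 2                       ∎)

x⊕y⊕y≡x : ∀ a b → a ⊕ b ⊕ b ≡ a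
x⊕y⊕y≡x a b = trans (⊕-assoc a b b) (trans (cong (a ⊕_) (⊕-self b)) (⊕-identityʳ a))

x⊕y⊕z≡x⊕z⊕y : ∀ a b c → a ⊕ b ⊕ c ≡ a ⊕ c ⊕ b
x⊕y⊕z≡x⊕z⊕y a b c =
  trans (⊕-assoc a b c) (trans (cong (a ⊕_) (⊕-comm b c)) (sym (⊕-assoc a c b)))

⊕-cancelʳ : ∀ {a b} c → a ⊕ c ≡ b ⊕ c → a ≡ b
⊕-cancelʳ {a} {b} c eq = trans (sym (x⊕y⊕y≡x a c)) (trans (cong (_⊕ c) eq) (x⊕y⊕y≡x b c))

⊕-cancelˡ : ∀ c {a b} → c ⊕ a ≡ c ⊕ b → a ≡ b
⊕-cancelˡ c {a} {b} eq = ⊕-cancelʳ c (trans (⊕-comm a c) (trans eq (⊕-comm c b)))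

bigXor-cong : ∀ n {f g} → (∀ t → t < n → f t ≡ g t) → bigXor n f ≡ bigXor n g
bigXor-cong zero    _      = refl
bigXor-cong (suc n) f≗g =
  cong₂ _⊕_ (bigXor-cong n λ t t<n → f≗g t (m≤n⇒m≤1+n t<n)) (f≗g n ≤-refl)

bigXor-change : ∀ n {f g i} → i < n → (∀ t → t < n → t ≢ i → g t ≡ f t) →
  bigXor n g ⊕ g i ≡ bigXor n f ⊕ f i
bigXor-change (suc n) {f} {g} {i} i<1+n agree with i ≟ n
... | yes refl = begin
  bigXor n g ⊕ g n ⊕ g n ≡⟨ x⊕y⊕y≡x (bigXor n g) (g n) ⟩
  bigXor n g             ≡⟨ bigXor-cong n (λ t t<n → agree t (m≤n⇒m≤1+n t<n) (<⇒≢ t<n)) ⟩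
  bigXor n f             ≡⟨ x⊕y⊕y≡x (bigXor n f) (f n) ⟨
  bigXor n f ⊕ f n ⊕ f n ∎
  where open ≡-Reasoning
... | no i≢n = begin
  bigXor n g ⊕ g n ⊕ g i ≡⟨ x⊕y⊕z≡x⊕z⊕y (bigXor n g) (g n) (g i) ⟩
  bigXor n g ⊕ g i ⊕ g n ≡⟨ cong₂ _⊕_ (bigXor-change n (≤∧≢⇒< (s≤s⁻¹ i<1+n) i≢n)
                                        (λ t t<n → agree t (m≤n⇒m≤1+n t<n)))
                                      (agree n ≤-refl (≢-sym i≢n)) ⟩
  bigXor n f ⊕ f i ⊕ f n ≡⟨ x⊕y⊕z≡x⊕z⊕y (bigXor n f) (f i) (f n) ⟩
  bigXor n f ⊕ f n ⊕ f i ∎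
  where open ≡-Reasoning

bigXor-agree-at : ∀ n {f g i} → i < n → (∀ t → t < n → t ≢ i → g t ≡ f t) →
  bigXor n g ≡ bigXor n f → g i ≡ f i
bigXor-agree-at n {f} {g} {i} i<n agree eq =
  ⊕-cancelˡ (bigXor n f) (trans (cong (_⊕ g i) (sym eq)) (bigXor-change n i<n agree))

bigXor-cleared : ∀ n {f g i} → i < n → (∀ t → t < n → t ≢ i → g t ≡ f t) →
  g i ≡ f i ⊕ bigXor n f → bigXor n g ≡ 0
bigXor-cleared n {f} {g} {i} i<n agree gi≡ = ⊕-cancelʳ (g i) (begin
  bigXor n g ⊕ g i ≡⟨ bigXor-change n i<n agree ⟩
  bigXor n f ⊕ f i ≡⟨ ⊕-comm (bigXor n f) (f i) ⟩
  f i ⊕ bigXor n f ≡⟨ gi≡ ⟨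
  g i              ≡⟨ ⊕-identityˡ (g i) ⟨
  0 ⊕ g i          ∎)
  where open ≡-Reasoning

bigXor-/2 : ∀ n f → bigXor n f / 2 ≡ bigXor n (λ t → f t / 2)
bigXor-/2 zero    f = refl
bigXor-/2 (suc n) f = trans (⊕-/2 (bigXor n f) (f n)) (cong (λ x → x ⊕ f n / 2) (bigXor-/2 n f))

bigXor-odd : ∀ n f → bigXor n f % 2 ≡ 1 → ∃ λ t → t < n × f t % 2 ≡ 1
bigXor-odd (suc n) f odd with %2-cases (f n)
... | inj₂ fn-odd  = n , ≤-refl , fn-odd
... | inj₁ fn-even = let t , t<n , ft-odd = bigXor-odd n f rest-odd in t , m≤n⇒m≤1+n t<n , ft-odd
  where
  open ≡-Reasoning
  rest-odd : bigXor n f % 2 ≡ 1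
  rest-odd = begin
    bigXor n f % 2                    ≡⟨ bitXor-identityʳ (m%n<n (bigXor n f) 2) ⟨
    bitXor (bigXor n f % 2) 0         ≡⟨ cong (bitXor (bigXor n f % 2)) fn-even ⟨
    bitXor (bigXor n f % 2) (f n % 2) ≡⟨ ⊕-%2 (bigXor n f) (f n) ⟨
    bigXor (suc n) f % 2              ≡⟨ odd ⟩
    1                                 ∎

-- Recursion on the binary length of the nim-sum X: a pile reducible for the
-- halved piles and X / 2 is reducible, and if X = 1 every odd pile is.
nim-reducible : ∀ n f → bigXor n f ≢ 0 → ∃ λ t → t < n × f t ⊕ bigXor n f < f t
nim-reducible n f X≢0 =
  halving-induction P (λ _ _ 0≢0 → contradiction refl 0≢0) step (bigXor n f) 0 0 f refl X≢0
  where
  P : ℕ → ℕ → ℕ → Set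
  P X _ _ = ∀ f → bigXor n f ≡ X → X ≢ 0 → ∃ λ t → t < n × f t ⊕ X < f t
  step : ∀ X b c → P (X / 2) (b / 2) (c / 2) → P X b c
  step X _ _ ih f X≡ X≢0 with X / 2 ≟ 0
  ... | no X/2≢0 =
    let t , t<n , lt = ih (λ t → f t / 2) (trans (sym (bigXor-/2 n f)) (cong (_/ 2) X≡)) X/2≢0
    in t , t<n , /2-<⇒< (subst (_< f t / 2) (sym (⊕-/2 (f t) X)) lt)
  ... | yes X/2≡0 =
    let t , t<n , ft-odd = bigXor-odd n f (trans (cong (_% 2) X≡) X-odd)
    in t , t<n , %2-<⇒< (trans (⊕-/2 (f t) X) (trans (cong (f t / 2 ⊕_) X/2≡0) (⊕-identityʳ _)))
                        (subst₂ _<_ (sym (trans (⊕-%2 (f t) X) (cong₂ bitXor ft-odd X-odd)))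
                                    (sym ft-odd) z<s)
    where
    X-odd : X % 2 ≡ 1
    X-odd with %2-cases X
    ... | inj₂ odd  = odd
    ... | inj₁ even = contradiction (≡-by-halves X/2≡0 even) X≢0

-- Parity arithmetic

m+kn≡o+ln⇒m≡o : ∀ {N a b} c d → a < N → b < N → a + c * N ≡ b + d * N → a ≡ b
m+kn≡o+ln⇒m≡o {suc N} {a} {b} c d a<N b<N eq = begin
  a                       ≡⟨ m<n⇒m%n≡m a<N ⟨
  a % suc N               ≡⟨ [m+kn]%n≡m%n a c (suc N) ⟨
  (a + c * suc N) % suc N ≡⟨ cong (_% suc N) eq ⟩
  (b + d * suc N) % suc N ≡⟨ [m+kn]%n≡m%n b d (suc N) ⟩
  b % suc N               ≡⟨ m<n⇒m%n≡m b<N ⟩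
  b                       ∎
  where open ≡-Reasoning

%2-of-even-offset : ∀ {a b} c m → a + c * (2 * m) ≡ b → a % 2 ≡ b % 2
%2-of-even-offset {a} c m eq = begin
  a % 2                 ≡⟨ [m+kn]%n≡m%n a (c * m) 2 ⟨
  (a + c * m * 2) % 2   ≡⟨ cong (λ k → (a + k) % 2) (*-assoc c m 2) ⟩
  (a + c * (m * 2)) % 2 ≡⟨ cong (λ k → (a + c * k) % 2) (*-comm m 2) ⟩
  (a + c * (2 * m)) % 2 ≡⟨ cong (_% 2) eq ⟩
  _                     ∎
  where open ≡-Reasoning

odd-shift-flips-parity : ∀ a s → s % 2 ≡ 1 → a % 2 ≢ (a + s) % 2
odd-shift-flips-parity a s s-odd eq = flip (a % 2) (m%n<n a 2) (trans eq (begin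
  (a + s) % 2           ≡⟨ %-distribˡ-+ a s 2 ⟩
  (a % 2 + s % 2) % 2   ≡⟨ cong (λ r → (a % 2 + r) % 2) s-odd ⟩
  (a % 2 + 1) % 2       ∎))
  where
  open ≡-Reasoning
  flip : ∀ r → r < 2 → r ≢ (r + 1) % 2
  flip 0 _ ()
  flip 1 _ ()
  flip (suc (suc _)) (s≤s (s≤s ()))

odd-complement-≤ : ∀ {h} r w → h % 2 ≡ 1 → h < 2 * r + 1 → suc r + w ≤ h + 1 → 2 * w + 1 ≤ h
odd-complement-≤ {h} r w h-odd h<2r+1 1+r+w≤h+1 =
  subst (2 * w + 1 ≤_) (sym h≡) (+-monoˡ-≤ 1 (*-monoʳ-≤ 2 w≤u))
  where
  u : ℕ
  u = h / 2
  h≡ : h ≡ 2 * u + 1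
  h≡ = trans (m≡2[m/2]+m%2 h) (cong (2 * u +_) h-odd)
  u<r : u < r
  u<r = *-cancelˡ-< 2 u r (+-cancelʳ-< 1 (2 * u) (2 * r) (subst (_< 2 * r + 1) h≡ h<2r+1))
  h+1≡ : ∀ u → 2 * u + 1 + 1 ≡ suc (suc u + u)
  h+1≡ = solve-∀
  w≤u : w ≤ u
  w≤u = +-cancelˡ-≤ (suc u) w u (begin
    suc u + w ≤⟨ +-monoˡ-≤ w u<r ⟩
    r + w     ≤⟨ s≤s⁻¹ (subst (suc r + w ≤_) (trans (cong (_+ 1) h≡) (h+1≡ u)) 1+r+w≤h+1) ⟩
    suc u + u ∎)
    where open ≤-Reasoning

even-odd-gap : ∀ t₀ t₁ → (∃ λ r → 2 * t₁ + 1 ≡ 2 * t₀ + 0 + (2 * r + 1))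
                       ⊎ (∃ λ r → 2 * t₀ + 0 ≡ 2 * t₁ + 1 + (2 * r + 1))
even-odd-gap t₀ t₁ with t₀ ≤? t₁
... | yes t₀≤t₁ = let r , t₀+r≡t₁ = m≤n⇒∃[o]m+o≡n t₀≤t₁
                  in inj₁ (r , trans (cong (λ t → 2 * t + 1) (sym t₀+r≡t₁)) (gap t₀ r))
  where
  gap : ∀ t r → 2 * (t + r) + 1 ≡ 2 * t + 0 + (2 * r + 1)
  gap = solve-∀
... | no t₀≰t₁ = let r , 1+t₁+r≡t₀ = m≤n⇒∃[o]m+o≡n (≰⇒> t₀≰t₁)
                 in inj₂ (r , trans (cong (λ t → 2 * t + 0) (sym 1+t₁+r≡t₀)) (gap t₁ r))
  where
  gap : ∀ t r → 2 * (suc t + r) + 0 ≡ 2 * t + 1 + (2 * r + 1)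
  gap = solve-∀

-- Positions, moves and the kernel of the game

tokens : ∀ {N} → Position N → ℕ
tokens {zero}  p = 0
tokens {suc N} p = p Fin.zero + tokens (p ∘ Fin.suc)

tokens-mono-≤ : ∀ {N} {p q : Position N} → (∀ x → q x ≤ p x) → tokens q ≤ tokens p
tokens-mono-≤ {zero}  _   = z≤n
tokens-mono-≤ {suc N} q≤p = +-mono-≤ (q≤p Fin.zero) (tokens-mono-≤ (q≤p ∘ Fin.suc))

tokens-mono-< : ∀ {N} {p q : Position N} → (∀ x → q x ≤ p x) → (∃ λ x → q x < p x) →
  tokens q < tokens p
tokens-mono-< {suc N} q≤p (Fin.zero  , lt) = +-mono-<-≤ lt (tokens-mono-≤ (q≤p ∘ Fin.suc))
tokens-mono-< {suc N} q≤p (Fin.suc x , lt) =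
  +-mono-≤-< (q≤p Fin.zero) (tokens-mono-< (q≤p ∘ Fin.suc) (x , lt))

-- Move N S k p q unfolds to  s , s ∈ S , i , j , j < k , Lowers (InBlock N s i j) p q.
Lowers : ∀ {N} → (Fin N → Set) → Position N → Position N → Set
Lowers D p q = (∀ x → q x ≤ p x) × (∀ x → ¬ D x → q x ≡ p x) × (∃ λ x → q x < p x)

Move⇒tokens< : ∀ {N S k} {p q : Position N} → Move N S k p q → tokens q < tokens p
Move⇒tokens< (_ , _ , _ , _ , _ , q≤p , _ , strict) = tokens-mono-< q≤p strict

block-move : ∀ {N S k s i j} {D : Fin N → Set} {p q} → S s → j < k →
  (∀ x → D x → InBlock N s i j x) → Lowers D p q → Move N S k p q
block-move {s = s} {i} {j} s∈S j<k D⊆block (q≤p , outside-D , strict) =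
  s , s∈S , i , j , j<k , q≤p , (λ x ∉block → outside-D x (∉block ∘ D⊆block x)) , strict

single-pile-move : ∀ {N S k s} {a : Fin N} {p q} → S s → 0 < k → Lowers (_≡ a) p q →
  Move N S k p q
single-pile-move {s = s} {a} s∈S 0<k =
  block-move {s = s} {a} {0} s∈S 0<k λ { _ refl → 0 , z≤n , 0 , refl }

lowers-updateAt : ∀ {N} (p : Position N) a {v} → v < p a → Lowers (_≡ a) p (updateAt p a (const v))
lowers-updateAt p a {v} v<pa = q≤p , (λ x x≢a → updateAt-minimal x a p x≢a) , (a , qa<pa)
  where
  qa<pa : updateAt p a (const v) a < p a
  qa<pa = subst (_< p a) (sym (updateAt-updates a p)) v<pa
  q≤p : ∀ x → updateAt p a (const v) x ≤ p x
  q≤p x with x Fin.≟ a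
  ... | yes refl = <⇒≤ qa<pa
  ... | no x≢a   = ≤-reflexive (updateAt-minimal x a p x≢a)

lowers-trans : ∀ {N} {D E : Fin N → Set} {p q r} → Lowers D p q → Lowers E q r →
  Lowers (λ x → D x ⊎ E x) p r
lowers-trans (q≤p , outside-D , x , qx<px) (r≤q , outside-E , _) =
    (λ y → ≤-trans (r≤q y) (q≤p y))
  , (λ y y∉ → trans (outside-E y (y∉ ∘ inj₂)) (outside-D y (y∉ ∘ inj₁)))
  , (x , ≤-<-trans (r≤q x) qx<px)

pile-toℕ : ∀ {N} (p : Position N) x → pile p (toℕ x) ≡ p x
pile-toℕ {N} p x with toℕ x <? N
... | yes x<N = cong p (fromℕ<-toℕ x x<N)
... | no  x≮N = contradiction (toℕ<n x) x≮N

pile-cong : ∀ {N} {p q : Position N} y → (∀ x → toℕ x ≡ y → q x ≡ p x) → pile q y ≡ pile p y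
pile-cong {N} y q≗p with y <? N
... | yes y<N = q≗p (fromℕ< y<N) (toℕ-fromℕ< y<N)
... | no  _   = refl

pile-updateAt-≢ : ∀ {N} (p : Position N) a {f y} → y ≢ toℕ a → pile (updateAt p a f) y ≡ pile p y
pile-updateAt-≢ p a {y = y} y≢a =
  pile-cong y λ x x≡y → updateAt-minimal x a p λ x≡a → y≢a (trans (sym x≡y) (cong toℕ x≡a))

IsP⇒¬IsN : ∀ {N S k p} → IsP N S k p → ¬ IsN N S k p
IsP⇒¬IsN (isP p→N) (isN q p→q q-P) = IsP⇒¬IsN q-P (p→N q p→q)

module Kernel {N S k} (K : Position N → Set) (K? : ∀ p → Dec (K p))
  (independent : ∀ {p q} → K p → Move N S k p q → ¬ K q)
  (absorbing : ∀ p → ¬ K p → ∃ λ q → Move N S k p q × K q) where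

  private
    classify : ∀ n p → tokens p < n → (K p → IsP N S k p) × (¬ K p → IsN N S k p)
    classify (suc n) p tokens<1+n =
        (λ Kp → isP λ q p→q → proj₂ (classify n q (smaller p→q)) (independent Kp p→q))
      , (λ ¬Kp → let q , p→q , Kq = absorbing p ¬Kp
                 in isN q p→q (proj₁ (classify n q (smaller p→q)) Kq))
      where
      smaller : ∀ {q} → Move N S k p q → tokens q < n
      smaller p→q = <-≤-trans (Move⇒tokens< p→q) (s≤s⁻¹ tokens<1+n)

  IsP⇔K : ∀ p → IsP N S k p ⇔ K p
  IsP⇔K p = let K⇒P , ¬K⇒N = classify _ p ≤-refl
            in mk⇔ (λ P → decidable-stable (K? p) λ ¬Kp → IsP⇒¬IsN P (¬K⇒N ¬Kp)) K⇒P

-- ECN((2m)_{1,3,…,h}, 2)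

module CircularNim (m : ℕ) where

  parityClass : ℕ → Position (2 * m) → ℕ → ℕ
  parityClass e p t = pile p (2 * t + e)

  nimSum : ℕ → Position (2 * m) → ℕ
  nimSum e p = bigXor m (parityClass e p)

  Balanced : Position (2 * m) → Set
  Balanced p = nimSum 0 p ≡ 0 × nimSum 1 p ≡ 0

  Balanced? : ∀ p → Dec (Balanced p)
  Balanced? p = nimSum 0 p ≟ 0 ×-dec nimSum 1 p ≟ 0

  Balanced⇒nimSum≡0 : ∀ {p e} → Balanced p → e < 2 → nimSum e p ≡ 0
  Balanced⇒nimSum≡0 (X₀≡0 , _)    (s≤s z≤n)       = X₀≡0
  Balanced⇒nimSum≡0 (_    , X₁≡0) (s≤s (s≤s z≤n)) = X₁≡0

  Balanced⇔ : ∀ p → Balanced p ⇔ (bigXor m (λ t → pile p (2 * t)) ≡ 0 × nimSum 1 p ≡ 0)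
  Balanced⇔ p = mk⇔ (map₁ (trans (sym even≡))) (map₁ (trans even≡))
    where
    even≡ : nimSum 0 p ≡ bigXor m (λ t → pile p (2 * t))
    even≡ = bigXor-cong m λ t _ → cong (pile p) (+-identityʳ (2 * t))

  class-index< : ∀ {e t} → e < 2 → t < m → 2 * t + e < 2 * m
  class-index< {e} {t} e<2 t<m = begin-strict
    2 * t + e <⟨ +-monoʳ-< (2 * t) e<2 ⟩
    2 * t + 2 ≡⟨ trans (+-comm (2 * t) 2) (sym (*-suc 2 t)) ⟩
    2 * suc t ≤⟨ *-monoʳ-≤ 2 t<m ⟩
    2 * m     ∎
    where open ≤-Reasoning

  equal-shifts-coincide : ∀ (x y : Fin (2 * m)) {b} c d →
    toℕ x + c * (2 * m) ≡ b → toℕ y + d * (2 * m) ≡ b → x ≡ y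
  equal-shifts-coincide x y c d ex ey =
    toℕ-injective (m+kn≡o+ln⇒m≡o c d (toℕ<n x) (toℕ<n y) (trans ex (sym ey)))

  unequal-shifts-differ-in-parity : ∀ (x y i : Fin (2 * m)) s c d → s % 2 ≡ 1 →
    toℕ x + c * (2 * m) ≡ toℕ i + 0 * s → toℕ y + d * (2 * m) ≡ toℕ i + 1 * s →
    toℕ x % 2 ≢ toℕ y % 2
  unequal-shifts-differ-in-parity x y i s c d s-odd ex ey x≡y[2] =
    odd-shift-flips-parity (toℕ i) s s-odd (begin
      toℕ i % 2           ≡⟨ cong (_% 2) (+-identityʳ (toℕ i)) ⟨
      (toℕ i + 0 * s) % 2 ≡⟨ %2-of-even-offset c m ex ⟨
      toℕ x % 2           ≡⟨ x≡y[2] ⟩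
      toℕ y % 2           ≡⟨ %2-of-even-offset d m ey ⟩
      (toℕ i + 1 * s) % 2 ≡⟨ cong (λ k → (toℕ i + k) % 2) (*-identityˡ s) ⟩
      (toℕ i + s) % 2     ∎)
    where open ≡-Reasoning

  block-parity : ∀ {s j} {i x y : Fin (2 * m)} → s % 2 ≡ 1 → j ≤ 1 →
    InBlock (2 * m) s i j x → InBlock (2 * m) s i j y → toℕ x % 2 ≡ toℕ y % 2 → x ≡ y
  block-parity {x = x} {y} _ _ (0 , _ , c , ex) (0 , _ , d , ey) _ =
    equal-shifts-coincide x y c d ex ey
  block-parity {x = x} {y} _ _ (1 , _ , c , ex) (1 , _ , d , ey) _ =
    equal-shifts-coincide x y c d ex ey
  block-parity {s} {i = i} {x} {y} s-odd _ (0 , _ , c , ex) (1 , _ , d , ey) x≡y[2] =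
    ⊥-elim (unequal-shifts-differ-in-parity x y i s c d s-odd ex ey x≡y[2])
  block-parity {s} {i = i} {x} {y} s-odd _ (1 , _ , c , ex) (0 , _ , d , ey) x≡y[2] =
    ⊥-elim (unequal-shifts-differ-in-parity y x i s d c s-odd ey ex (sym x≡y[2]))
  block-parity _ j≤1 (suc (suc _) , t≤j , _) _ _ =
    contradiction (≤-trans t≤j j≤1) λ { (s≤s ()) }
  block-parity _ j≤1 _ (suc (suc _) , t≤j , _) _ =
    contradiction (≤-trans t≤j j≤1) λ { (s≤s ()) }

  -- A changed pile lies in the block only up to double negation; decidability
  -- of Fin equality recovers the conclusion.
  move-changes-one-pile-per-parity : ∀ {h p q} {x y : Fin (2 * m)} →
    Move (2 * m) (OddUpTo h) 2 p q → q x ≢ p x → q y ≢ p y → toℕ x % 2 ≡ toℕ y % 2 → x ≡ y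
  move-changes-one-pile-per-parity {x = x} {y} (_ , (s-odd , _) , _ , _ , j<2 , _ , unchanged , _)
    qx≢px qy≢py x≡y[2] =
    decidable-stable (x Fin.≟ y) λ x≢y →
      qx≢px (unchanged x λ x∈ → qy≢py (unchanged y λ y∈ →
        x≢y (block-parity s-odd (s≤s⁻¹ j<2) x∈ y∈ x≡y[2])))

  Balanced-independent : ∀ {h p q} → Balanced p → Move (2 * m) (OddUpTo h) 2 p q → ¬ Balanced q
  Balanced-independent {p = p} {q} bal-p p→q@(_ , _ , _ , _ , _ , _ , _ , x₀ , qx₀<px₀) bal-q =
    <⇒≢ qx₀<px₀ qx₀≡px₀
    where
    e t₀ : ℕ
    e  = toℕ x₀ % 2
    t₀ = toℕ x₀ / 2
    e<2 : e < 2
    e<2 = m%n<n (toℕ x₀) 2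
    x₀≡ : toℕ x₀ ≡ 2 * t₀ + e
    x₀≡ = m≡2[m/2]+m%2 (toℕ x₀)
    t₀<m : t₀ < m
    t₀<m = m<n*o⇒m/o<n (subst (toℕ x₀ <_) (*-comm 2 m) (toℕ<n x₀))
    unchanged : ∀ t → t < m → t ≢ t₀ → parityClass e q t ≡ parityClass e p t
    unchanged t _ t≢t₀ = pile-cong _ λ x x≡ → decidable-stable (q x ≟ p x) λ qx≢px →
      let x≡x₀ = move-changes-one-pile-per-parity p→q qx≢px (<⇒≢ qx₀<px₀)
                   (trans (cong (_% 2) x≡) ([2q+r]%2≡r t e<2))
      in t≢t₀ (*-cancelˡ-≡ t t₀ 2 (+-cancelʳ-≡ e _ _
                 (trans (sym x≡) (trans (cong toℕ x≡x₀) x₀≡))))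
    qx₀≡px₀ : q x₀ ≡ p x₀
    qx₀≡px₀ = begin
      q x₀                ≡⟨ pile-toℕ q x₀ ⟨
      pile q (toℕ x₀)     ≡⟨ cong (pile q) x₀≡ ⟩
      parityClass e q t₀  ≡⟨ bigXor-agree-at m t₀<m unchanged
                               (trans (Balanced⇒nimSum≡0 bal-q e<2)
                                      (sym (Balanced⇒nimSum≡0 bal-p e<2))) ⟩
      parityClass e p t₀  ≡⟨ cong (pile p) x₀≡ ⟨
      pile p (toℕ x₀)     ≡⟨ pile-toℕ p x₀ ⟩
      p x₀                ∎
      where open ≡-Reasoning

  record ClassReduction (e : ℕ) (p : Position (2 * m)) : Set where
    field
      half             : ℕ
      target           : Fin (2 * m)
      target≡          : toℕ target ≡ 2 * half + e
      next             : Position (2 * m)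
      lowers           : Lowers (_≡ target) p next
      cleared          : nimSum e next ≡ 0
      others-unchanged : ∀ {e′} → e′ < 2 → e′ ≢ e → nimSum e′ next ≡ nimSum e′ p

  reduce-class : ∀ {e} p → e < 2 → nimSum e p ≢ 0 → ClassReduction e p
  reduce-class {e} p e<2 X≢0 with nim-reducible m (parityClass e p) X≢0
  ... | t , t<m , reduces = record
    { half = t ; target = a ; target≡ = a≡ ; next = q
    ; lowers = lowers-updateAt p a v<pa ; cleared = cleared ; others-unchanged = others-unchanged }
    where
    a : Fin (2 * m)
    a = fromℕ< (class-index< e<2 t<m)
    a≡ : toℕ a ≡ 2 * t + e
    a≡ = toℕ-fromℕ< (class-index< e<2 t<m)
    v : ℕ
    v = parityClass e p t ⊕ nimSum e p
    q : Position (2 * m)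
    q = updateAt p a (const v)
    v<pa : v < p a
    v<pa = subst (v <_) (trans (cong (pile p) (sym a≡)) (pile-toℕ p a)) reduces
    elsewhere : ∀ e′ t′ → 2 * t′ + e′ ≢ toℕ a →
                parityClass e′ q t′ ≡ parityClass e′ p t′
    elsewhere _ _ = pile-updateAt-≢ p a
    cleared : nimSum e q ≡ 0
    cleared = bigXor-cleared m t<m
      (λ t′ _ t′≢t → elsewhere e t′ λ eq →
         t′≢t (*-cancelˡ-≡ t′ t 2 (+-cancelʳ-≡ e _ _ (trans eq a≡))))
      (trans (cong (pile q) (sym a≡)) (trans (pile-toℕ q a) (updateAt-updates a p)))
    others-unchanged : ∀ {e′} → e′ < 2 → e′ ≢ e → nimSum e′ q ≡ nimSum e′ p
    others-unchanged {e′} e′<2 e′≢e = bigXor-cong m λ t′ _ → elsewhere e′ t′ λ eq →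
      e′≢e (trans (sym ([2q+r]%2≡r t′ e′<2))
                  (trans (cong (_% 2) (trans eq a≡)) ([2q+r]%2≡r t e<2)))

  module _ (h : ℕ) (h-odd : h % 2 ≡ 1) (m<h+2 : m < h + 2) where

    1∈S : OddUpTo h 1
    1∈S = refl , n≢0⇒n>0 λ h≡0 → 0≢1+n (trans (cong (_% 2) (sym h≡0)) h-odd)

    -- Either step d = 2r + 1 from a, or wrap around with step 2m − d from b.
    odd-gap-block : ∀ {a b : Fin (2 * m)} r → toℕ b ≡ toℕ a + (2 * r + 1) →
      ∃ λ s → OddUpTo h s × ∃ λ i → ∀ x → x ≡ a ⊎ x ≡ b → InBlock (2 * m) s i 1 x
    odd-gap-block {a} {b} r b≡ with 2 * r + 1 ≤? h
    ... | yes d≤h = 2 * r + 1 , ([2q+r]%2≡r r ≤-refl , d≤h) , a ,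
                    λ { _ (inj₁ refl) → 0 , z≤n , 0 , refl
                      ; _ (inj₂ refl) → 1 , ≤-refl , 0 , forward }
      where
      forward : toℕ b + 0 * (2 * m) ≡ toℕ a + 1 * (2 * r + 1)
      forward =
        trans (+-identityʳ (toℕ b)) (trans b≡ (cong (toℕ a +_) (sym (*-identityˡ (2 * r + 1)))))
    ... | no d≰h = 2 * w + 1 , ([2q+r]%2≡r w ≤-refl , w-fits) , b ,
                   λ { _ (inj₁ refl) → 1 , ≤-refl , 1 , backward
                     ; _ (inj₂ refl) → 0 , z≤n , 0 , refl }
      where
      open ≡-Reasoning
      r<m : r < m
      r<m = *-cancelˡ-< 2 r m (≤-<-trans (m≤m+n (2 * r) 1)
              (≤-<-trans (m≤n+m (2 * r + 1) (toℕ a)) (subst (_< 2 * m) b≡ (toℕ<n b))))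
      w : ℕ
      w = proj₁ (m≤n⇒∃[o]m+o≡n r<m)
      1+r+w≡m : suc r + w ≡ m
      1+r+w≡m = proj₂ (m≤n⇒∃[o]m+o≡n r<m)
      w-fits : 2 * w + 1 ≤ h
      w-fits = odd-complement-≤ r w h-odd (≰⇒> d≰h)
                 (subst (_≤ h + 1) (sym 1+r+w≡m) (s≤s⁻¹ (subst (m <_) (+-suc h 1) m<h+2)))
      wrap-around : ∀ a r w → a + 1 * (2 * (suc r + w)) ≡ a + (2 * r + 1) + 1 * (2 * w + 1)
      wrap-around = solve-∀
      backward : toℕ a + 1 * (2 * m) ≡ toℕ b + 1 * (2 * w + 1)
      backward = begin
        toℕ a + 1 * (2 * m)                   ≡⟨ cong (λ n → toℕ a + 1 * (2 * n)) 1+r+w≡m ⟨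
        toℕ a + 1 * (2 * (suc r + w))         ≡⟨ wrap-around (toℕ a) r w ⟩
        toℕ a + (2 * r + 1) + 1 * (2 * w + 1) ≡⟨ cong (_+ 1 * (2 * w + 1)) b≡ ⟨
        toℕ b + 1 * (2 * w + 1)               ∎

    pair-block : ∀ {a b : Fin (2 * m)} t₀ t₁ → toℕ a ≡ 2 * t₀ + 0 → toℕ b ≡ 2 * t₁ + 1 →
      ∃ λ s → OddUpTo h s × ∃ λ i → ∀ x → x ≡ a ⊎ x ≡ b → InBlock (2 * m) s i 1 x
    pair-block t₀ t₁ a≡ b≡ with even-odd-gap t₀ t₁
    ... | inj₁ (r , gap) = odd-gap-block r (trans b≡ (trans gap (cong (_+ (2 * r + 1)) (sym a≡))))
    ... | inj₂ (r , gap) =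
      let s , s∈ , i , ⊆block =
            odd-gap-block r (trans a≡ (trans gap (cong (_+ (2 * r + 1)) (sym b≡))))
      in s , s∈ , i , λ x → ⊆block x ∘ swap

    Balanced-absorbing : ∀ p → ¬ Balanced p → ∃ λ q → Move (2 * m) (OddUpTo h) 2 p q × Balanced q
    Balanced-absorbing p ¬bal with nimSum 0 p ≟ 0 | nimSum 1 p ≟ 0
    ... | yes X₀≡0 | yes X₁≡0 = contradiction (X₀≡0 , X₁≡0) ¬bal
    ... | yes X₀≡0 | no  X₁≢0 =
      next , single-pile-move 1∈S z<s lowers , trans (others-unchanged z<s λ ()) X₀≡0 , cleared
      where open ClassReduction (reduce-class p ≤-refl X₁≢0)
    ... | no  X₀≢0 | yes X₁≡0 =
      next , single-pile-move 1∈S z<s lowers , cleared , trans (others-unchanged ≤-refl λ ()) X₁≡0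
      where open ClassReduction (reduce-class p z<s X₀≢0)
    ... | no  X₀≢0 | no  X₁≢0 =
      let s , s∈ , i , ⊆block = pair-block (half R₀) (half R₁) (target≡ R₀) (target≡ R₁)
      in next R₁ , block-move s∈ ≤-refl ⊆block (lowers-trans (lowers R₀) (lowers R₁)) ,
         trans (others-unchanged R₁ z<s λ ()) (cleared R₀) , cleared R₁
      where
      open ClassReduction
      R₀ : ClassReduction 0 p
      R₀ = reduce-class p z<s X₀≢0
      R₁ : ClassReduction 1 (next R₀)
      R₁ = reduce-class (next R₀) ≤-refl (X₁≢0 ∘ trans (sym (others-unchanged R₀ ≤-refl λ ())))

mainTheorem14 : (m : ℕ) → 1 < m →
    (h : ℕ) → h % 2 ≡ 1 → h ≤ m → m < h + 2 →
    (M : Position (2 * m)) →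
    IsP (2 * m) (OddUpTo h) 2 M ⇔
      (bigXor m (λ t → pile M (2 * t)) ≡ 0 × bigXor m (λ t → pile M (2 * t + 1)) ≡ 0)
mainTheorem14 m _ h h-odd _ m<h+2 M =
  Balanced⇔ M ⇔-∘ IsP⇔K Balanced Balanced? Balanced-independent (Balanced-absorbing h h-odd m<h+2) M
  where
  open CircularNim m
  open Kernel
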